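{- Let $P_n$ denote the path on $n$ vertices with every vertex having initial weight $1$. Then $\lim_{n\to\infty} a_t(P_n)/n$ exists and equals $\inf_{n\ge1} a_t(P_n)/n$.
   Context: Let $G$ be a graph whose vertices carry nonnegative integer weights $w(v)$. An acquisition move consists of choosing adjacent vertices $u,v$ with current weights satisfying $w(u)\ge w(v)>0$ and transferring all of the weight of $v$ to $u$. A sequence of acquisition moves after which no further move is possible is an acquisition protocol; the set of vertices with nonzero weight at its end is the residual set. The total acquisition number $a_t(G)$ is the minimum size of a residual set over all acquisition protocols. -}

module Defs where

open import Data.Nat using (ℕ; zero; suc; _+_; _≤_; _<_)
open import Data.Nat.Properties using () renaming (_≟_ to _≟ℕ_)
open import Data.Fin using (Fin; toℕ)
open import Data.Fin.Properties using (_≟_)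
open import Data.List using (length; filter; allFin)
open import Data.Sum using (_⊎_)
open import Data.Product using (Σ; _×_)
open import Data.Empty using (⊥)
open import Relation.Nullary using (yes; no; ¬?)
open import Relation.Binary.PropositionalEquality using (_≡_)
open import Relation.Binary.Construct.Closure.ReflexiveTransitive using (Star)

Graph : ℕ → Set₁
Graph n = Fin n → Fin n → Set

Weighting : ℕ → Set
Weighting n = Fin n → ℕ

transfer : ∀ {n} → Weighting n → Fin n → Fin n → Weighting n
transfer w u v x with x ≟ v
... | yes _ = 0
... | no _ with x ≟ u
...   | yes _ = w u + w v
...   | no _ = w x

data Move {n} (G : Graph n) : Weighting n → Weighting n → Set where
  acquire : ∀ {w} (u v : Fin n) → G u v → w v ≤ w u → 0 < w v →
            Move G w (transfer w u v)

Terminal : ∀ {n} → Graph n → Weighting n → Set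
Terminal {n} G w = (u v : Fin n) → G u v → w v ≤ w u → 0 < w v → ⊥

residualSize : ∀ {n} → Weighting n → ℕ
residualSize {n} w = length (filter (λ x → ¬? (w x ≟ℕ 0)) (allFin n))

Protocol : ∀ {n} → Graph n → Weighting n → Weighting n → Set
Protocol G w₀ w = Star (Move G) w₀ w × Terminal G w

IsTotalAcqNumber : ∀ {n} → Graph n → Weighting n → ℕ → Set
IsTotalAcqNumber {n} G w₀ k =
  Σ (Weighting n) (λ w → Protocol G w₀ w × residualSize w ≡ k)
  × ((w : Weighting n) → Protocol G w₀ w → k ≤ residualSize w)

Path : (n : ℕ) → Graph n
Path n i j = suc (toℕ i) ≡ toℕ j ⊎ suc (toℕ j) ≡ toℕ i

unitWeights : (n : ℕ) → Weighting n
unitWeights n _ = 1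

-- Acquisition on a path started from unit weights never creates a weight above 4: as long as two adjacent
-- vertices are both occupied each carries at most 2, and a vertex of weight at least 2 has at most one occupied
-- neighbour (the invariant Sparse). Since moves conserve the total weight n, every residual set has at least
-- n/4 vertices. Conversely, merging each block {4b, …, 4b+3} into 4b+1 by the moves 4b+1 ← 4b, 4b+2 ← 4b+3,
-- 4b+1 ← 4b+2 and then playing on until no move is possible leaves at most n/4 + 3 vertices. Hence
-- n/4 ≤ a_t(P_n) ≤ n/4 + 3: the ratios a_t(P_n)/n tend to 1/4 and are never below it.

module Submission where

open import Defs

module _ where
  open import Data.Nat using (ℕ; zero; suc; _+_; _*_; _≤?_; _<?_; z≤n; s≤s)
  open import Data.Nat as ℕ using (_≤_; _<_)
  open import Data.Nat.DivMod using (_/_; _%_; m/n*n≤m; m≡m%n+[m/n]*n; m%n<n)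
  open import Data.Nat.Properties as ℕ using (≤-refl; ≤-trans; ≤-reflexive; +-mono-≤)
  open import Data.Nat.Solver using (module +-*-Solver)
  open import Data.Fin using (Fin; toℕ; fromℕ<) renaming (zero to fzero; suc to fsuc)
  open import Data.Fin.Properties using (toℕ-injective; toℕ-fromℕ<; any?; _≟_)
  open import Data.List using (length; filter; tabulate)
  open import Data.Sum using (_⊎_; inj₁; inj₂; [_,_]′)
  open import Data.Product using (Σ-syntax; _×_; _,_)
  open import Data.Empty using (⊥; ⊥-elim)
  open import Function using (_∘_)
  open import Relation.Nullary using (yes; no; ¬?)
  open import Relation.Nullary.Decidable using (True; toWitness; _×-dec_; _⊎-dec_)
  open import Relation.Binary.Definitions using (Decidable; Irreflexive)
  open import Relation.Binary.PropositionalEquality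
    using (_≡_; _≢_; _≗_; refl; sym; trans; cong; cong₂; subst; module ≡-Reasoning)
  open import Relation.Binary.Construct.Closure.ReflexiveTransitive using (Star; ε; _◅_; _◅◅_)
  open import Algebra.Properties.Semiring.Sum ℕ.+-*-semiring
    using (sum; sum-cong-≗; ∑-distrib-+; sum-replicate-zero; *-distribˡ-sum)

  private
    variable
      n : ℕ

  Path-sym : {x y : Fin n} → Path n x y → Path n y x
  Path-sym (inj₁ p) = inj₂ p
  Path-sym (inj₂ p) = inj₁ p

  Path-irrefl : Irreflexive _≡_ (Path n)
  Path-irrefl refl (inj₁ p) = ℕ.1+n≢n p
  Path-irrefl refl (inj₂ p) = ℕ.1+n≢n p

  Path? : Decidable (Path n)
  Path? x y = (suc (toℕ x) ℕ.≟ toℕ y) ⊎-dec (suc (toℕ y) ℕ.≟ toℕ x)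

  right-neighbour-unique : {x y z : Fin n} → suc (toℕ x) ≡ toℕ y → suc (toℕ x) ≡ toℕ z → y ≡ z
  right-neighbour-unique p q = toℕ-injective (trans (sym p) q)

  left-neighbour-unique : {x y z : Fin n} → suc (toℕ y) ≡ toℕ x → suc (toℕ z) ≡ toℕ x → y ≡ z
  left-neighbour-unique p q = toℕ-injective (ℕ.suc-injective (trans p (sym q)))

  Path-at-most-two-neighbours : {x y z t : Fin n} → Path n x y → Path n x z → Path n x t →
                                y ≡ z ⊎ y ≡ t ⊎ z ≡ t
  Path-at-most-two-neighbours (inj₁ p) (inj₁ q) _        = inj₁ (right-neighbour-unique p q)
  Path-at-most-two-neighbours (inj₂ p) (inj₂ q) _        = inj₁ (left-neighbour-unique p q)
  Path-at-most-two-neighbours (inj₁ p) (inj₂ _) (inj₁ r) = inj₂ (inj₁ (right-neighbour-unique p r))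
  Path-at-most-two-neighbours (inj₂ p) (inj₁ _) (inj₂ r) = inj₂ (inj₁ (left-neighbour-unique p r))
  Path-at-most-two-neighbours (inj₁ _) (inj₂ q) (inj₂ r) = inj₂ (inj₂ (left-neighbour-unique q r))
  Path-at-most-two-neighbours (inj₂ _) (inj₁ q) (inj₁ r) = inj₂ (inj₂ (right-neighbour-unique q r))

  data Site (u v x : Fin n) : Set where
    donor     : x ≡ v → Site u v x
    acquirer  : x ≡ u → Site u v x
    elsewhere : x ≢ v → x ≢ u → Site u v x

  site : (u v x : Fin n) → Site u v x
  site u v x with x ≟ v | x ≟ u
  ... | yes x≡v | _       = donor x≡v
  ... | no _    | yes x≡u = acquirer x≡u
  ... | no x≢v  | no x≢u  = elsewhere x≢v x≢u

  module _ (w : Weighting n) (u v : Fin n) where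

    transfer-donor : transfer w u v v ≡ 0
    transfer-donor with v ≟ v
    ... | yes _  = refl
    ... | no v≢v = ⊥-elim (v≢v refl)

    transfer-acquirer : u ≢ v → transfer w u v u ≡ w u + w v
    transfer-acquirer u≢v with u ≟ v
    ... | yes u≡v = ⊥-elim (u≢v u≡v)
    ... | no _ with u ≟ u
    ...   | yes _  = refl
    ...   | no u≢u = ⊥-elim (u≢u refl)

    transfer-elsewhere : ∀ {x} → x ≢ v → x ≢ u → transfer w u v x ≡ w x
    transfer-elsewhere {x} x≢v x≢u with x ≟ v
    ... | yes x≡v = ⊥-elim (x≢v x≡v)
    ... | no _ with x ≟ u
    ...   | yes x≡u = ⊥-elim (x≢u x≡u)
    ...   | no _    = refl

  pointMass : Fin n → ℕ → Fin n → ℕ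
  pointMass fzero    c fzero    = c
  pointMass fzero    c (fsuc _) = 0
  pointMass (fsuc _) c fzero    = 0
  pointMass (fsuc a) c (fsuc x) = pointMass a c x

  pointMass-self : (a : Fin n) (c : ℕ) → pointMass a c a ≡ c
  pointMass-self fzero    c = refl
  pointMass-self (fsuc a) c = pointMass-self a c

  pointMass-other : {a x : Fin n} (c : ℕ) → x ≢ a → pointMass a c x ≡ 0
  pointMass-other {a = fzero}  {fzero}  c x≢a = ⊥-elim (x≢a refl)
  pointMass-other {a = fzero}  {fsuc _} c _   = refl
  pointMass-other {a = fsuc _} {fzero}  c _   = refl
  pointMass-other {a = fsuc a} {fsuc x} c x≢a = pointMass-other c (x≢a ∘ cong fsuc)

  sum-pointMass : (a : Fin n) (c : ℕ) → sum (pointMass a c) ≡ c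
  sum-pointMass {suc n} fzero    c = trans (cong (c +_) (sum-replicate-zero n)) (ℕ.+-identityʳ c)
  sum-pointMass         (fsuc a) c = sum-pointMass a c

  sum-plus-pointMass : (f : Fin n → ℕ) (a : Fin n) (c : ℕ) → sum (λ x → f x + pointMass a c x) ≡ sum f + c
  sum-plus-pointMass f a c = trans (∑-distrib-+ f (pointMass a c)) (cong (sum f +_) (sum-pointMass a c))

  sum-ones : sum {n} (λ _ → 1) ≡ n
  sum-ones {zero}  = refl
  sum-ones {suc n} = cong suc sum-ones

  sum-mono-≤ : {f g : Fin n → ℕ} → (∀ x → f x ≤ g x) → sum f ≤ sum g
  sum-mono-≤ {zero}  f≤g = z≤n
  sum-mono-≤ {suc n} f≤g = +-mono-≤ (f≤g fzero) (sum-mono-≤ (f≤g ∘ fsuc))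

  sgn : ℕ → ℕ
  sgn zero    = 0
  sgn (suc _) = 1

  occupied : Weighting n → ℕ
  occupied w = sum (sgn ∘ w)

  length-filter-positive : ∀ {m} (w : Weighting m) (f : Fin n → Fin m) →
    length (filter (λ x → ¬? (w x ℕ.≟ 0)) (tabulate f)) ≡ sum (sgn ∘ w ∘ f)
  length-filter-positive {n = zero}  w f = refl
  length-filter-positive {n = suc n} w f with w (f fzero)
  ... | zero  = length-filter-positive w (f ∘ fsuc)
  ... | suc _ = cong suc (length-filter-positive w (f ∘ fsuc))

  residualSize≡occupied : (w : Weighting n) → residualSize w ≡ occupied w
  residualSize≡occupied w = length-filter-positive w (λ x → x)

  module _ {G : Graph n} (loopless : Irreflexive _≡_ G) where

    move-conserves-sum : ∀ {w w′} → Move G w w′ → sum w′ ≡ sum w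
    move-conserves-sum (acquire {w} u v uv _ _) = ℕ.+-cancelʳ-≡ (w v) _ _ (begin
      sum w′ + w v                           ≡⟨ sum-plus-pointMass w′ v (w v) ⟨
      sum (λ x → w′ x + pointMass v (w v) x) ≡⟨ sum-cong-≗ pointwise ⟩
      sum (λ x → w x + pointMass u (w v) x)  ≡⟨ sum-plus-pointMass w u (w v) ⟩
      sum w + w v                            ∎)
      where
      open ≡-Reasoning
      w′ : Weighting n
      w′ = transfer w u v
      u≢v : u ≢ v
      u≢v u≡v = loopless u≡v uv
      pointwise : ∀ x → w′ x + pointMass v (w v) x ≡ w x + pointMass u (w v) x
      pointwise x with site u v x
      ... | donor refl
        rewrite transfer-donor w u v | pointMass-self v (w v) | pointMass-other (w v) (u≢v ∘ sym)
        = sym (ℕ.+-identityʳ (w v))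
      ... | acquirer refl
        rewrite transfer-acquirer w u v u≢v | pointMass-self u (w v) | pointMass-other (w v) u≢v
        = ℕ.+-identityʳ (w u + w v)
      ... | elsewhere x≢v x≢u
        rewrite transfer-elsewhere w u v x≢v x≢u | pointMass-other (w v) x≢v | pointMass-other (w v) x≢u
        = refl

    moves-conserve-sum : ∀ {w w′} → Star (Move G) w w′ → sum w′ ≡ sum w
    moves-conserve-sum ε        = refl
    moves-conserve-sum (m ◅ ms) = trans (moves-conserve-sum ms) (move-conserves-sum m)

    move-frees-one-vertex : ∀ {w w′} → Move G w w′ → suc (occupied w′) ≡ occupied w
    move-frees-one-vertex (acquire {w} u v uv v≤u 0<v) = begin
      suc (occupied w′)                        ≡⟨ ℕ.+-comm 1 (occupied w′) ⟩
      occupied w′ + 1                          ≡⟨ sum-plus-pointMass (sgn ∘ w′) v 1 ⟨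
      sum (λ x → sgn (w′ x) + pointMass v 1 x) ≡⟨ sum-cong-≗ pointwise ⟩
      occupied w                               ∎
      where
      open ≡-Reasoning
      w′ : Weighting n
      w′ = transfer w u v
      u≢v : u ≢ v
      u≢v u≡v = loopless u≡v uv
      sgn-pos : ∀ {k} → 0 < k → sgn k ≡ 1
      sgn-pos (s≤s _) = refl
      0<u : 0 < w u
      0<u = ≤-trans 0<v v≤u
      pointwise : ∀ x → sgn (w′ x) + pointMass v 1 x ≡ sgn (w x)
      pointwise x with site u v x
      ... | donor refl
        rewrite transfer-donor w u v | pointMass-self v 1 | sgn-pos 0<v = refl
      ... | acquirer refl
        rewrite transfer-acquirer w u v u≢v | pointMass-other 1 u≢v
              | sgn-pos (ℕ.<-≤-trans 0<u (ℕ.m≤m+n (w u) (w v))) | sgn-pos 0<u = refl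
      ... | elsewhere x≢v x≢u
        rewrite transfer-elsewhere w u v x≢v x≢u | pointMass-other 1 x≢v = ℕ.+-identityʳ (sgn (w x))

    module _ (G? : Decidable G) where

      protocol-from : (w : Weighting n) → Σ[ w′ ∈ Weighting n ] Protocol G w w′ × occupied w′ ≤ occupied w
      protocol-from w = go (occupied w) w refl
        where
        -- Recursion on the number of occupied vertices, which every move lowers by one.
        go : ∀ k w → occupied w ≡ k → Σ[ w′ ∈ Weighting n ] Protocol G w w′ × occupied w′ ≤ occupied w
        go k w occ with any? (λ u → any? (λ v → G? u v ×-dec (w v ≤? w u) ×-dec (0 <? w v)))
        ... | no stuck = w , (ε , λ u v uv v≤u 0<v → stuck (u , v , uv , v≤u , 0<v)) , ≤-refl
        go zero    w occ | yes (u , v , uv , v≤u , 0<v) =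
          ⊥-elim (ℕ.1+n≢0 (trans (move-frees-one-vertex (acquire u v uv v≤u 0<v)) occ))
        go (suc k) w occ | yes (u , v , uv , v≤u , 0<v)
          with frees ← move-frees-one-vertex (acquire u v uv v≤u 0<v)
          with go k (transfer w u v) (ℕ.suc-injective (trans frees occ))
        ... | w′ , (moves , stuck) , fewer =
          w′ , (acquire u v uv v≤u 0<v ◅ moves , stuck) , ≤-trans (ℕ.m≤n⇒m≤1+n fewer) (≤-reflexive frees)

  record Sparse (w : Weighting n) : Set where
    field
      weight≤4    : ∀ x → w x ≤ 4
      crowded≤2   : ∀ {x y} → Path n x y → 0 < w x → 0 < w y → w y ≤ 2
      heavy⇒alone : ∀ {x y z} → Path n x y → Path n x z → y ≢ z → 2 ≤ w x → 0 < w y → 0 < w z → ⊥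

  unitWeights-sparse : Sparse (unitWeights n)
  unitWeights-sparse = record
    { weight≤4    = λ _ → s≤s z≤n
    ; crowded≤2   = λ _ _ _ → s≤s z≤n
    ; heavy⇒alone = λ { _ _ _ (s≤s ()) _ _ }
    }

  move-preserves-sparse : ∀ {w w′} → Move (Path n) w w′ → Sparse w → Sparse w′
  move-preserves-sparse {n} (acquire {w} a d ad d≤a 0<d) sparse = record
    { weight≤4 = weight≤4′ ; crowded≤2 = crowded≤2′ ; heavy⇒alone = heavy⇒alone′ }
    where
    open Sparse sparse
    w′ : Weighting n
    w′ = transfer w a d
    a≢d : a ≢ d
    a≢d a≡d = Path-irrefl a≡d ad
    0<a : 0 < w a
    0<a = ≤-trans 0<d d≤a

    occupied-before : ∀ {y} → 0 < w′ y → y ≢ d × 0 < w y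
    occupied-before {y} 0<y′ with site a d y
    ... | donor refl        = ⊥-elim (ℕ.<-irrefl (sym (transfer-donor w a d)) 0<y′)
    ... | acquirer refl     = a≢d , 0<a
    ... | elsewhere y≢d y≢a = y≢d , subst (0 <_) (transfer-elsewhere w a d y≢d y≢a) 0<y′

    weight≤4′ : ∀ x → w′ x ≤ 4
    weight≤4′ x with site a d x
    ... | donor refl = subst (_≤ 4) (sym (transfer-donor w a d)) z≤n
    ... | acquirer refl = subst (_≤ 4) (sym (transfer-acquirer w a d a≢d))
                            (+-mono-≤ (crowded≤2 (Path-sym ad) 0<d 0<a) (crowded≤2 ad 0<a 0<d))
    ... | elsewhere x≢d x≢a = subst (_≤ 4) (sym (transfer-elsewhere w a d x≢d x≢a)) (weight≤4 x)

    crowded≤2′ : ∀ {x y} → Path n x y → 0 < w′ x → 0 < w′ y → w′ y ≤ 2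
    crowded≤2′ {x} {y} xy 0<x′ 0<y′
      with x≢d , 0<x ← occupied-before 0<x′ | y≢d , 0<y ← occupied-before 0<y′ | site a d y
    ... | donor y≡d = ⊥-elim (y≢d y≡d)
    ... | elsewhere y≢d y≢a =
      subst (_≤ 2) (sym (transfer-elsewhere w a d y≢d y≢a)) (crowded≤2 xy 0<x 0<y)
    ... | acquirer refl with w a ≤? 1
    ...   | yes a≤1 = subst (_≤ 2) (sym (transfer-acquirer w a d a≢d)) (+-mono-≤ a≤1 (≤-trans d≤a a≤1))
    ...   | no  a≰1 = ⊥-elim (heavy⇒alone (Path-sym xy) ad x≢d (ℕ.≰⇒> a≰1) 0<x 0<d)

    heavy⇒alone′ : ∀ {x y z} → Path n x y → Path n x z → y ≢ z → 2 ≤ w′ x → 0 < w′ y → 0 < w′ z → ⊥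
    heavy⇒alone′ {x} {y} {z} xy xz y≢z 2≤x′ 0<y′ 0<z′
      with y≢d , 0<y ← occupied-before 0<y′ | z≢d , 0<z ← occupied-before 0<z′
         | x≢d , _   ← occupied-before (≤-trans (s≤s z≤n) 2≤x′) | site a d x
    ... | donor x≡d = x≢d x≡d
    ... | acquirer refl = [ y≢z , [ y≢d , z≢d ]′ ]′ (Path-at-most-two-neighbours xy xz ad)
    ... | elsewhere x≢d x≢a =
      heavy⇒alone xy xz y≢z (subst (2 ≤_) (transfer-elsewhere w a d x≢d x≢a) 2≤x′) 0<y 0<z

  moves-preserve-sparse : ∀ {w w′} → Star (Move (Path n)) w w′ → Sparse w → Sparse w′
  moves-preserve-sparse ε        = λ sparse → sparse
  moves-preserve-sparse (m ◅ ms) = moves-preserve-sparse ms ∘ move-preserves-sparse m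

  residualSize-lower-bound : ∀ {w} → Protocol (Path n) (unitWeights n) w → n ≤ 4 * residualSize w
  residualSize-lower-bound {n} {w} (moves , _) = begin
    n                          ≡⟨ sum-ones ⟨
    sum (unitWeights n)        ≡⟨ moves-conserve-sum Path-irrefl moves ⟨
    sum w                      ≤⟨ sum-mono-≤ (λ x → ≤4⇒≤4*sgn (weight≤4 x)) ⟩
    sum (λ x → 4 * sgn (w x))  ≡⟨ *-distribˡ-sum 4 (sgn ∘ w) ⟨
    4 * occupied w             ≡⟨ cong (4 *_) (residualSize≡occupied w) ⟨
    4 * residualSize w         ∎
    where
    open ℕ.≤-Reasoning
    open Sparse (moves-preserve-sparse moves unitWeights-sparse)
    ≤4⇒≤4*sgn : ∀ {k} → k ≤ 4 → k ≤ 4 * sgn k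
    ≤4⇒≤4*sgn {zero}  _   = z≤n
    ≤4⇒≤4*sgn {suc k} k≤4 = k≤4

  -- collapsed i j is the weight at vertex j once each of the first i blocks {4b, …, 4b+3}
  -- of the unit-weighted path has been merged into its vertex 4b+1.
  collapsed : ℕ → ℕ → ℕ
  collapsed zero    _                         = 1
  collapsed (suc i) 0                         = 0
  collapsed (suc i) 1                         = 4
  collapsed (suc i) 2                         = 0
  collapsed (suc i) 3                         = 0
  collapsed (suc i) (suc (suc (suc (suc j)))) = collapsed i j

  collapsed-unmerged : ∀ i c → collapsed i (i * 4 + c) ≡ 1
  collapsed-unmerged zero    c = refl
  collapsed-unmerged (suc i) c = collapsed-unmerged i c

  collapsed-last-block : ∀ i c → collapsed (suc i) (i * 4 + c) ≡ collapsed 1 c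
  collapsed-last-block zero    c = refl
  collapsed-last-block (suc i) c = collapsed-last-block i c

  collapsed-outside-last-block : ∀ i j → j ≢ i * 4 + 0 → j ≢ i * 4 + 1 → j ≢ i * 4 + 2 → j ≢ i * 4 + 3 →
                                 collapsed (suc i) j ≡ collapsed i j
  collapsed-outside-last-block zero    0 j≢0 _ _ _ = ⊥-elim (j≢0 refl)
  collapsed-outside-last-block zero    1 _ j≢1 _ _ = ⊥-elim (j≢1 refl)
  collapsed-outside-last-block zero    2 _ _ j≢2 _ = ⊥-elim (j≢2 refl)
  collapsed-outside-last-block zero    3 _ _ _ j≢3 = ⊥-elim (j≢3 refl)
  collapsed-outside-last-block zero    (suc (suc (suc (suc j)))) _ _ _ _ = refl
  collapsed-outside-last-block (suc i) 0 _ _ _ _ = refl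
  collapsed-outside-last-block (suc i) 1 _ _ _ _ = refl
  collapsed-outside-last-block (suc i) 2 _ _ _ _ = refl
  collapsed-outside-last-block (suc i) 3 _ _ _ _ = refl
  collapsed-outside-last-block (suc i) (suc (suc (suc (suc j)))) j≢0 j≢1 j≢2 j≢3 =
    collapsed-outside-last-block i j (j≢0 ∘ cong (4 +_)) (j≢1 ∘ cong (4 +_))
                                     (j≢2 ∘ cong (4 +_)) (j≢3 ∘ cong (4 +_))

  merge-equal : ∀ {G : Graph n} {w u v c} → G u v → w u ≡ suc c → w v ≡ suc c → Move G w (transfer w u v)
  merge-equal uv u≡ v≡ = acquire _ _ uv (≤-reflexive (trans v≡ (sym u≡))) (subst (0 <_) (sym v≡) (s≤s z≤n))

  module CollapseNextBlock {n} (i : ℕ) (block≤n : suc i * 4 ≤ n) (w : Weighting n)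
                           (w≗ : w ≗ collapsed i ∘ toℕ) where
    k : ℕ
    k = i * 4

    vertex : ∀ c {c<4 : True (c <? 4)} → Fin n
    vertex c {c<4} = fromℕ< (≤-trans (ℕ.+-monoʳ-< k (toWitness c<4)) (subst (_≤ n) (ℕ.+-comm 4 k) block≤n))

    toℕ-vertex : ∀ c {c<4 : True (c <? 4)} → toℕ (vertex c {c<4}) ≡ k + c
    toℕ-vertex c = toℕ-fromℕ< _

    b₀ b₁ b₂ b₃ : Fin n
    b₀ = vertex 0
    b₁ = vertex 1
    b₂ = vertex 2
    b₃ = vertex 3

    distinct : ∀ {x y : Fin n} {c c′} → toℕ x ≡ k + c → toℕ y ≡ k + c′ → c ≢ c′ → x ≢ y
    distinct x≡ y≡ c≢c′ refl = c≢c′ (ℕ.+-cancelˡ-≡ k _ _ (trans (sym x≡) y≡))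

    consecutive : ∀ {x y : Fin n} {c} → toℕ x ≡ k + c → toℕ y ≡ k + suc c → suc (toℕ x) ≡ toℕ y
    consecutive {c = c} x≡ y≡ = trans (cong suc x≡) (trans (sym (ℕ.+-suc k c)) (sym y≡))

    unmerged : ∀ c {c<4 : True (c <? 4)} → w (vertex c {c<4}) ≡ 1
    unmerged c {c<4} = trans (w≗ _) (trans (cong (collapsed i) (toℕ-vertex c {c<4}))
                                           (collapsed-unmerged i c))

    w₁ w₂ w₃ : Weighting n
    w₁ = transfer w b₁ b₀
    w₂ = transfer w₁ b₂ b₃
    w₃ = transfer w₂ b₁ b₂

    b₁≢b₀ : b₁ ≢ b₀
    b₁≢b₀ = distinct (toℕ-vertex 1) (toℕ-vertex 0) (λ ())
    b₂≢b₀ : b₂ ≢ b₀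
    b₂≢b₀ = distinct (toℕ-vertex 2) (toℕ-vertex 0) (λ ())
    b₂≢b₁ : b₂ ≢ b₁
    b₂≢b₁ = distinct (toℕ-vertex 2) (toℕ-vertex 1) (λ ())
    b₃≢b₀ : b₃ ≢ b₀
    b₃≢b₀ = distinct (toℕ-vertex 3) (toℕ-vertex 0) (λ ())
    b₃≢b₁ : b₃ ≢ b₁
    b₃≢b₁ = distinct (toℕ-vertex 3) (toℕ-vertex 1) (λ ())
    b₃≢b₂ : b₃ ≢ b₂
    b₃≢b₂ = distinct (toℕ-vertex 3) (toℕ-vertex 2) (λ ())

    w₁b₁≡2 : w₁ b₁ ≡ 2
    w₁b₁≡2 = trans (transfer-acquirer w b₁ b₀ b₁≢b₀) (cong₂ _+_ (unmerged 1) (unmerged 0))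
    w₁b₂≡1 : w₁ b₂ ≡ 1
    w₁b₂≡1 = trans (transfer-elsewhere w b₁ b₀ b₂≢b₀ b₂≢b₁) (unmerged 2)
    w₁b₃≡1 : w₁ b₃ ≡ 1
    w₁b₃≡1 = trans (transfer-elsewhere w b₁ b₀ b₃≢b₀ b₃≢b₁) (unmerged 3)
    w₂b₁≡2 : w₂ b₁ ≡ 2
    w₂b₁≡2 = trans (transfer-elsewhere w₁ b₂ b₃ (b₃≢b₁ ∘ sym) (b₂≢b₁ ∘ sym)) w₁b₁≡2
    w₂b₂≡2 : w₂ b₂ ≡ 2
    w₂b₂≡2 = trans (transfer-acquirer w₁ b₂ b₃ (b₃≢b₂ ∘ sym)) (cong₂ _+_ w₁b₂≡1 w₁b₃≡1)

    moves : Star (Move (Path n)) w w₃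
    moves = merge-equal (inj₂ (consecutive (toℕ-vertex 0) (toℕ-vertex 1))) (unmerged 1) (unmerged 0)
          ◅ merge-equal (inj₁ (consecutive (toℕ-vertex 2) (toℕ-vertex 3))) w₁b₂≡1 w₁b₃≡1
          ◅ merge-equal (inj₁ (consecutive (toℕ-vertex 1) (toℕ-vertex 2))) w₂b₁≡2 w₂b₂≡2
          ◅ ε

    last-block : ∀ {x : Fin n} c → toℕ x ≡ k + c → collapsed (suc i) (toℕ x) ≡ collapsed 1 c
    last-block c x≡ = trans (cong (collapsed (suc i)) x≡) (collapsed-last-block i c)

    w₃≗ : w₃ ≗ collapsed (suc i) ∘ toℕ
    w₃≗ x with site b₁ b₂ x
    ... | donor refl = trans (transfer-donor w₂ b₁ b₂) (sym (last-block 2 (toℕ-vertex 2)))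
    ... | acquirer refl = trans (transfer-acquirer w₂ b₁ b₂ (b₂≢b₁ ∘ sym))
                            (trans (cong₂ _+_ w₂b₁≡2 w₂b₂≡2) (sym (last-block 1 (toℕ-vertex 1))))
    ... | elsewhere x≢b₂ x≢b₁ with site b₂ b₃ x
    ...   | donor refl = trans (transfer-elsewhere w₂ b₁ b₂ x≢b₂ x≢b₁)
                           (trans (transfer-donor w₁ b₂ b₃) (sym (last-block 3 (toℕ-vertex 3))))
    ...   | acquirer x≡b₂ = ⊥-elim (x≢b₂ x≡b₂)
    ...   | elsewhere x≢b₃ _ with site b₁ b₀ x
    ...     | donor refl = trans (transfer-elsewhere w₂ b₁ b₂ x≢b₂ x≢b₁)
                             (trans (transfer-elsewhere w₁ b₂ b₃ x≢b₃ x≢b₂)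
                             (trans (transfer-donor w b₁ b₀) (sym (last-block 0 (toℕ-vertex 0)))))
    ...     | acquirer x≡b₁ = ⊥-elim (x≢b₁ x≡b₁)
    ...     | elsewhere x≢b₀ _ = begin
      w₃ x                          ≡⟨ transfer-elsewhere w₂ b₁ b₂ x≢b₂ x≢b₁ ⟩
      w₂ x                          ≡⟨ transfer-elsewhere w₁ b₂ b₃ x≢b₃ x≢b₂ ⟩
      w₁ x                          ≡⟨ transfer-elsewhere w b₁ b₀ x≢b₀ x≢b₁ ⟩
      w x                           ≡⟨ w≗ x ⟩
      collapsed i (toℕ x)           ≡⟨ collapsed-outside-last-block i (toℕ x)
                                         (outside x≢b₀ (toℕ-vertex 0)) (outside x≢b₁ (toℕ-vertex 1))
                                         (outside x≢b₂ (toℕ-vertex 2)) (outside x≢b₃ (toℕ-vertex 3)) ⟨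
      collapsed (suc i) (toℕ x)     ∎
      where
      open ≡-Reasoning
      outside : ∀ {y c} → x ≢ y → toℕ y ≡ k + c → toℕ x ≢ k + c
      outside x≢y y≡ x≡ = x≢y (toℕ-injective (trans x≡ (sym y≡)))

  collapse-next-block : ∀ i → suc i * 4 ≤ n → (w : Weighting n) → w ≗ collapsed i ∘ toℕ →
    Σ[ w′ ∈ Weighting n ] Star (Move (Path n)) w w′ × w′ ≗ collapsed (suc i) ∘ toℕ
  collapse-next-block i block≤n w w≗ = w₃ , moves , w₃≗
    where open CollapseNextBlock i block≤n w w≗

  collapse-blocks : ∀ i → i * 4 ≤ n →
    Σ[ w ∈ Weighting n ] Star (Move (Path n)) (unitWeights n) w × w ≗ collapsed i ∘ toℕ
  collapse-blocks zero    _        = unitWeights _ , ε , λ _ → refl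
  collapse-blocks (suc i) blocks≤n
    with w , moves , w≗ ← collapse-blocks i (≤-trans (ℕ.m≤n+m (i * 4) 4) blocks≤n)
    with w′ , moves′ , w′≗ ← collapse-next-block i blocks≤n w w≗
    = w′ , moves ◅◅ moves′ , w′≗

  -- Every occupied vertex of a collapsed path carries weight 4, except for at most three unmerged ones.
  occupied-collapsed : ∀ i n → n < suc i * 4 →
    sum {n} (λ x → 4 * sgn (collapsed i (toℕ x))) ≤ sum {n} (λ x → collapsed i (toℕ x)) + 12
  occupied-collapsed zero    0 _ = z≤n
  occupied-collapsed zero    1 _ = ℕ.m≤m+n 4 9
  occupied-collapsed zero    2 _ = ℕ.m≤m+n 8 6
  occupied-collapsed zero    3 _ = ℕ.m≤m+n 12 3
  occupied-collapsed zero    (suc (suc (suc (suc _)))) (s≤s (s≤s (s≤s (s≤s ()))))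
  occupied-collapsed (suc i) 0 _ = z≤n
  occupied-collapsed (suc i) 1 _ = z≤n
  occupied-collapsed (suc i) 2 _ = ℕ.m≤n+m 4 12
  occupied-collapsed (suc i) 3 _ = ℕ.m≤n+m 4 12
  occupied-collapsed (suc i) (suc (suc (suc (suc n)))) (s≤s (s≤s (s≤s (s≤s n<)))) =
    s≤s (s≤s (s≤s (s≤s (occupied-collapsed i n n<))))

  residualSize-upper-bound : ∀ n →
    Σ[ w ∈ Weighting n ] Protocol (Path n) (unitWeights n) w × 4 * residualSize w ≤ n + 12
  residualSize-upper-bound n
    with w , moves , w≗ ← collapse-blocks (n / 4) (m/n*n≤m n 4)
    with w′ , (moves′ , stuck) , fewer ← protocol-from Path-irrefl Path? w
    = w′ , (moves ◅◅ moves′ , stuck) , (begin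
      4 * residualSize w′                           ≡⟨ cong (4 *_) (residualSize≡occupied w′) ⟩
      4 * occupied w′                               ≤⟨ ℕ.*-monoʳ-≤ 4 fewer ⟩
      4 * occupied w                                ≡⟨ *-distribˡ-sum 4 (sgn ∘ w) ⟩
      sum (λ x → 4 * sgn (w x))                     ≡⟨ sum-cong-≗ (cong (λ k → 4 * sgn k) ∘ w≗) ⟩
      sum {n} (λ x → 4 * sgn (collapsed i (toℕ x))) ≤⟨ occupied-collapsed i n n<[1+i]*4 ⟩
      sum {n} (λ x → collapsed i (toℕ x)) + 12      ≡⟨ cong (_+ 12) (sum-cong-≗ w≗) ⟨
      sum w + 12                                    ≡⟨ cong (_+ 12) (moves-conserve-sum Path-irrefl moves) ⟩
      sum (unitWeights n) + 12                      ≡⟨ cong (_+ 12) sum-ones ⟩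
      n + 12                                        ∎)
    where
    open ℕ.≤-Reasoning
    i : ℕ
    i = n / 4
    n<[1+i]*4 : n < suc i * 4
    n<[1+i]*4 = begin-strict
      n             ≡⟨ m≡m%n+[m/n]*n n 4 ⟩
      n % 4 + i * 4 <⟨ ℕ.+-monoˡ-< (i * 4) (m%n<n n 4) ⟩
      suc i * 4     ∎

  a_t-upper-bound : ∀ {k} → IsTotalAcqNumber (Path n) (unitWeights n) k → 4 * k ≤ n + 12
  a_t-upper-bound {n} (_ , minimal) with w , protocol , bound ← residualSize-upper-bound n =
    ≤-trans (ℕ.*-monoʳ-≤ 4 (minimal w protocol)) bound

  a_t-lower-bound : ∀ {k} → IsTotalAcqNumber (Path n) (unitWeights n) k → n ≤ 4 * k
  a_t-lower-bound ((w , protocol , refl) , _) = residualSize-lower-bound protocol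

  -- A/N ≤ (N + 12)/4N = 1/4 + 3/N ≤ B/M + 1/4D ≤ B/M + P/D, multiplied out and scaled by 4.
  cross-multiplied-bound : ∀ {A B N M D P} → 4 * A ≤ N + 12 → M ≤ 4 * B → 12 * D ≤ N → 1 ≤ P →
                           A * (M * D) ≤ (B * D + P * M) * N
  cross-multiplied-bound {A} {B} {N} {M} {D} {P} upper lower 12D≤N 1≤P = ℕ.*-cancelˡ-≤ 4 (begin
    4 * (A * (M * D))                   ≡⟨ ℕ.*-assoc 4 A (M * D) ⟨
    4 * A * (M * D)                     ≤⟨ ℕ.*-monoˡ-≤ (M * D) upper ⟩
    (N + 12) * (M * D)                  ≡⟨ solve 3 (λ N M D → (N :+ con 12) :* (M :* D)
                                                         := N :* (M :* D) :+ (con 12 :* D) :* M) refl N M D ⟩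
    N * (M * D) + 12 * D * M            ≤⟨ +-mono-≤ (ℕ.*-monoʳ-≤ N (ℕ.*-monoˡ-≤ D lower)) (ℕ.*-monoˡ-≤ M 12D≤N) ⟩
    N * (4 * B * D) + N * M             ≤⟨ ℕ.+-monoʳ-≤ (N * (4 * B * D)) (ℕ.*-monoʳ-≤ N M≤M*4P) ⟩
    N * (4 * B * D) + N * (M * (4 * P)) ≡⟨ solve 5 (λ B D P M N → N :* (con 4 :* B :* D) :+ N :* (M :* (con 4 :* P))
                                                         := con 4 :* ((B :* D :+ P :* M) :* N)) refl B D P M N ⟩
    4 * ((B * D + P * M) * N)           ∎)
    where
    open ℕ.≤-Reasoning
    open +-*-Solver using (solve; _:+_; _:*_; _:=_; con)
    M≤M*4P : M ≤ M * (4 * P)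
    M≤M*4P = ≤-trans (≤-reflexive (sym (ℕ.*-identityʳ M))) (ℕ.*-monoʳ-≤ M (≤-trans 1≤P (ℕ.m≤n*m P 4)))

open import Data.Nat using (ℕ; suc)
open import Data.Integer using (+_)
open import Data.Rational using (ℚ; _/_; _+_; _≤_; _<_; 0ℚ)
open import Data.Product using (∃-syntax)

import Data.Nat as ℕ
open import Data.Nat using (_*_; s≤s; z≤n)
open import Data.Nat.Properties using (m≤n⇒m≤1+n)
open import Data.Nat.Coprimality using (Coprime)
open import Data.Integer as ℤ using (-[1+_]; +<+)
import Data.Integer.Properties as ℤ
open import Data.Product using (_,_)
open import Data.Rational using (mkℚ; *<*; toℚᵘ)
open import Data.Rational.Properties using (toℚᵘ-cancel-≤; toℚᵘ-fromℚᵘ; toℚᵘ-homo-+)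
open import Data.Rational.Unnormalised as ℚᵘ using (mkℚᵘ; *≤*)
import Data.Rational.Unnormalised.Properties as ℚᵘ
open import Relation.Binary.PropositionalEquality using (_≡_; cong; cong₂; subst₂; module ≡-Reasoning)

cross-multiplied⇒≤ : ∀ {A B P n m d} .{c : Coprime P (suc d)} → A * (suc m * suc d) ℕ.≤ (B * suc d ℕ.+ P * suc m) * suc n →
                     (+ A) / suc n ≤ (+ B) / suc m + mkℚ (+ P) d c
cross-multiplied⇒≤ {A} {B} {P} {n} {m} {d} {c} ≤ =
  toℚᵘ-cancel-≤ (ℚᵘ.≤-respˡ-≃ (ℚᵘ.≃-sym (toℚᵘ-fromℚᵘ (mkℚᵘ (+ A) n)))
                (ℚᵘ.≤-respʳ-≃ (ℚᵘ.≃-sym toℚᵘ-rhs) (*≤* (subst₂ ℤ._≤_ lhs rhs (ℤ.+≤+ ≤)))))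
  where
  open ≡-Reasoning
  toℚᵘ-rhs : toℚᵘ ((+ B) / suc m + mkℚ (+ P) d c) ℚᵘ.≃ mkℚᵘ (+ B) m ℚᵘ.+ mkℚᵘ (+ P) d
  toℚᵘ-rhs = ℚᵘ.≃-trans (toℚᵘ-homo-+ ((+ B) / suc m) (mkℚ (+ P) d c))
                        (ℚᵘ.+-cong (toℚᵘ-fromℚᵘ (mkℚᵘ (+ B) m)) ℚᵘ.≃-refl)
  lhs : + (A * (suc m * suc d)) ≡ + A ℤ.* + (suc m * suc d)
  lhs = ℤ.pos-* A (suc m * suc d)
  rhs : + ((B * suc d ℕ.+ P * suc m) * suc n) ≡ (+ B ℤ.* + suc d ℤ.+ + P ℤ.* + suc m) ℤ.* + suc n
  rhs = begin
    + ((B * suc d ℕ.+ P * suc m) * suc n)             ≡⟨ ℤ.pos-* (B * suc d ℕ.+ P * suc m) (suc n) ⟩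
    + (B * suc d ℕ.+ P * suc m) ℤ.* + suc n           ≡⟨ cong (ℤ._* + suc n) (ℤ.pos-+ (B * suc d) (P * suc m)) ⟩
    (+ (B * suc d) ℤ.+ + (P * suc m)) ℤ.* + suc n     ≡⟨ cong (ℤ._* + suc n)
                                                           (cong₂ ℤ._+_ (ℤ.pos-* B (suc d)) (ℤ.pos-* P (suc m))) ⟩
    (+ B ℤ.* + suc d ℤ.+ + P ℤ.* + suc m) ℤ.* + suc n ∎

corollary2p1 : (a : ℕ → ℕ)
    → ((n : ℕ) → IsTotalAcqNumber (Path (suc n)) (unitWeights (suc n)) (a (suc n)))
    → (ε : ℚ) → 0ℚ < ε
    → ∃[ N ] ((n : ℕ) → N Data.Nat.≤ n → (m : ℕ)
        → (+ a (suc n)) / suc n ≤ ((+ a (suc m)) / suc m) + ε)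
corollary2p1 a a-is-a_t (mkℚ (+ 0)      _ _) (*<* (+<+ ()))
corollary2p1 a a-is-a_t (mkℚ -[1+ _ ] _ _) (*<* ())
corollary2p1 a a-is-a_t (mkℚ (+ suc p) d _) _ = 12 * suc d , λ n 12[1+d]≤n m →
  cross-multiplied⇒≤ {a (suc n)} {a (suc m)} (cross-multiplied-bound {a (suc n)} {a (suc m)} {D = suc d} {P = suc p}
    (a_t-upper-bound (a-is-a_t n)) (a_t-lower-bound (a-is-a_t m)) (m≤n⇒m≤1+n 12[1+d]≤n) (s≤s z≤n))
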